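{- Let $G$ be a finite, simple, connected graph with at least three vertices and $\dim_f(G)=\frac{|V(G)|}{2}$. Let $H$ be a finite, simple, connected graph with $|V(H)|\leq |V(G)|$. Then $\dim_f(G\Box H)=\frac{|V(G)|}{2}$.
   Context: The cartesian product $G\Box H$ has vertex set $V(G)\times V(H)$, with $(u_1,v_1)$ adjacent to $(u_2,v_2)$ iff either $u_1=u_2$ and $v_1v_2\in E(H)$, or $v_1=v_2$ and $u_1u_2\in E(G)$. For vertices $x,y$ of a connected graph $G$, $R\{x,y\}$ is the set of $z$ with $d(x,z)\neq d(y,z)$. A resolving function of $G$ is $f:V(G)\to[0,1]$ with $\sum_{z\in R\{x,y\}}f(z)\geq 1$ for all distinct $x,y$; $\dim_f(G)$ is the minimum of $\sum_{v\in V(G)}f(v)$ over all resolving functions.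
   Formalization: Resolving functions take values in the rationals between 0 and 1 rather than in the real interval $[0,1]$, so $\dim_f(G)$ and $\dim_f(G\Box H)$ are minima over rational resolving functions. -}

module Defs where

open import Data.Bool using (Bool; true; false; _∧_; _∨_; if_then_else_; T)
open import Data.Nat as ℕ using (ℕ; zero; suc; _≡ᵇ_)
open import Data.Fin as Fin using (Fin; remQuot)
open import Data.Fin.Properties using (_≟_)
open import Data.List using (allFin)
open import Data.Bool.ListAction using (any)
open import Data.Product using (_×_; _,_; ∃)
open import Data.Rational using (ℚ; 0ℚ; 1ℚ; _+_; _≤_)
open import Relation.Nullary using (¬_; does)
open import Relation.Binary.PropositionalEquality using (_≡_; _≢_)

record Graph : Set where
  field
    order : ℕ
    adj   : Fin order → Fin order → Bool
open Graph public

IsSimple : Graph → Set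
IsSimple G = (∀ x y → adj G x y ≡ adj G y x) × (∀ x → adj G x x ≡ false)

reach : (G : Graph) → ℕ → Fin (order G) → Fin (order G) → Bool
reach G zero    x y = does (x ≟ y)
reach G (suc k) x y = reach G k x y ∨ any (λ z → adj G x z ∧ reach G k z y) (allFin (order G))

Connected : Graph → Set
Connected G = (1 ℕ.≤ order G) × (∀ x y → ∃ λ k → T (reach G k x y))

searchDist : (G : Graph) → Fin (order G) → Fin (order G) → ℕ → ℕ → ℕ
searchDist G x y k zero    = k
searchDist G x y k (suc b) = if reach G k x y then k else searchDist G x y (suc k) b

-- shortest-path distance d(x,y) (in a connected graph some k < order G works)
dist : (G : Graph) → Fin (order G) → Fin (order G) → ℕ
dist G x y = searchDist G x y 0 (order G)

sumℚ : (n : ℕ) → (Fin n → ℚ) → ℚ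
sumℚ zero    f = 0ℚ
sumℚ (suc n) f = f Fin.zero + sumℚ n (λ i → f (Fin.suc i))

sumOverR : (G : Graph) → (Fin (order G) → ℚ) → Fin (order G) → Fin (order G) → ℚ
sumOverR G f x y = sumℚ (order G) (λ z → if dist G x z ≡ᵇ dist G y z then 0ℚ else f z)

IsResolvingFunction : (G : Graph) → (Fin (order G) → ℚ) → Set
IsResolvingFunction G f =
  (∀ v → 0ℚ ≤ f v × f v ≤ 1ℚ) × (∀ x y → x ≢ y → 1ℚ ≤ sumOverR G f x y)

FracDimIs : Graph → ℚ → Set
FracDimIs G q =
  (∃ λ f → IsResolvingFunction G f × sumℚ (order G) f ≡ q)
  × (∀ f → IsResolvingFunction G f → q ≤ sumℚ (order G) f)

-- cartesian product G □ H, vertex (u,v) encoded as Fin.combine u v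
_□_ : Graph → Graph → Graph
G □ H = record
  { order = order G ℕ.* order H
  ; adj   = λ i j → P (remQuot (order H) i) (remQuot (order H) j) }
  where
  P : Fin (order G) × Fin (order H) → Fin (order G) × Fin (order H) → Bool
  P (u₁ , v₁) (u₂ , v₂) =
    (does (u₁ ≟ u₂) ∧ adj H v₁ v₂) ∨ (does (v₁ ≟ v₂) ∧ adj G u₁ u₂)

-- A vertex v with no twin (a t ≠ v with d(v,z) = d(t,z) for all z ∉ {v,t}) lets weight ⅓ on v
-- and ½ elsewhere resolve G with total weight below |V(G)|/2; so dim_f(G) = |V(G)|/2 forces
-- every vertex of G to have a twin. Distances in G □ H add coordinatewise. Hence summing a
-- resolving function of G □ H over the copies of H, capped at 1, resolves G, and
-- dim_f(G □ H) ≥ dim_f(G). Conversely the constant 1/(2|V(H)|) resolves G □ H: (u,h) and (u,h′)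
-- are resolved by (x,h) and (x,h′) for each of the |V(G)| ≥ |V(H)| vertices x, and when u ≠ u′
-- twins supply two resolving vertices in each of the |V(H)| layers G × {w}.

module Submission where

open import Defs
open import Data.Bool using (Bool; true; false; _∧_; _∨_; if_then_else_; T)
open import Data.Bool.Properties as Bool using (T-∨; T-∧)
open import Data.Bool.ListAction using (any)
open import Data.Empty using (⊥-elim)
open import Data.Fin as Fin using (Fin; toℕ; combine; remQuot; _↑ˡ_; _↑ʳ_)
open import Data.Fin.Patterns using (0F; 1F; 2F)
open import Data.Fin.Properties
  using ( _≟_; any?; all?; ¬∀⟶∃¬; toℕ<n; pigeonhole
        ; combine-remQuot; remQuot-combine; combine-injectiveˡ)
open import Data.Integer as ℤ using (+_; +≤+)
import Data.Integer.Properties as ℤ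
import Data.Integer.Tactic.RingSolver as ℤ-Ring
open import Data.List using (allFin)
open import Data.List.Membership.Propositional using (lose)
open import Data.List.Membership.Propositional.Properties using (∈-allFin)
open import Data.List.Relation.Unary.Any using (satisfied)
open import Data.List.Relation.Unary.Any.Properties using (any⁺; any⁻)
open import Data.Nat using (ℕ; zero; suc; pred; >-nonZero; _+_; _*_; _≡ᵇ_; _≤_; _<_; z≤n; s≤s)
import Data.Nat.Properties as ℕ
import Data.Nat.Tactic.RingSolver as ℕ-Ring
open import Data.Product using (_×_; _,_; ∃; ∃₂; proj₁; proj₂; uncurry)
open import Data.Rational as ℚ using (ℚ; 0ℚ; 1ℚ; ½; _/_; toℚᵘ)
import Data.Rational.Properties as ℚ
open import Data.Rational.Unnormalised as ℚᵘ using (mkℚᵘ; *≡*; *≤*)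
import Data.Rational.Unnormalised.Properties as ℚᵘ
open import Algebra.Properties.CommutativeMonoid.Sum ℚ.+-0-commutativeMonoid
  using (sum; ∑-comm; sum-replicate-zero)
open import Data.Sum using (_⊎_; inj₁; inj₂)
open import Function using (Equivalence; _∘_; mk⇔)
open import Relation.Binary.Definitions using (tri<; tri≈; tri>)
open import Relation.Binary.PropositionalEquality
open import Relation.Nullary using (¬_; ¬?; Dec; yes; no; does)
open import Relation.Nullary.Decidable using (T?; _×-dec_; _→-dec_; dec-true; dec-false; does-⇔)

open Equivalence using (to; from)

T-≟⇒≡ : ∀ {n} {x y : Fin n} → T (does (x ≟ y)) → x ≡ y
T-≟⇒≡ {x = x} {y} t with x ≟ y
... | yes x≡y = x≡y

T-≟-diag : ∀ {n} (x : Fin n) → T (does (x ≟ x))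
T-≟-diag x with x ≟ x
... | yes _   = _
... | no x≢x = x≢x refl

third-vertex : ∀ {n} → 3 ≤ n → (a b : Fin n) → ∃ λ x → x ≢ a × x ≢ b
third-vertex (s≤s (s≤s (s≤s _))) a b with 0F ≟ a | 0F ≟ b | 1F ≟ a | 1F ≟ b
... | no 0≢a   | no 0≢b   | _        | _        = 0F , 0≢a , 0≢b
... | _        | _        | no 1≢a   | no 1≢b   = 1F , 1≢a , 1≢b
... | yes refl | _        | _        | yes refl = 2F , (λ ()) , (λ ())
... | _        | yes refl | yes refl | _        = 2F , (λ ()) , (λ ())
... | yes refl | _        | yes ()   | _
... | _        | yes refl | _        | yes ()

∀-combine : ∀ {n m} {P : Fin (n * m) → Set} → (∀ u h → P (combine u h)) → ∀ i → P i
∀-combine {n} {m} {P} p i = subst P (combine-remQuot {n} m i) (uncurry p (remQuot {n} m i))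

m+n≢n : ∀ m n → m ≢ 0 → m + n ≢ n
m+n≢n m n m≢0 m+n≡n = m≢0 (ℕ.+-cancelʳ-≡ n m 0 m+n≡n)

≡ᵇ-+ʳ : ∀ a b c → (a + c ≡ᵇ b + c) ≡ (a ≡ᵇ b)
≡ᵇ-+ʳ a b c = does-⇔ (mk⇔ (ℕ.+-cancelʳ-≡ c a b) (cong (_+ c))) (a + c ℕ.≟ b + c) (a ℕ.≟ b)

module _ (G : Graph) where

  private
    V = Fin (order G)

  reach-zero⇒≡ : ∀ {x y : V} → T (reach G 0 x y) → x ≡ y
  reach-zero⇒≡ = T-≟⇒≡

  reach-refl : ∀ (x : V) → T (reach G 0 x x)
  reach-refl = T-≟-diag

  reach-suc : ∀ k {x y : V} → T (reach G k x y) → T (reach G (suc k) x y)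
  reach-suc k r = from T-∨ (inj₁ r)

  reach-mono : ∀ {j k} {x y : V} → j ≤ k → T (reach G j x y) → T (reach G k x y)
  reach-mono {k = zero}  z≤n    r = r
  reach-mono {k = suc k} j≤1+k r with ℕ.m≤n⇒m<n∨m≡n j≤1+k
  ... | inj₁ (s≤s j≤k) = reach-suc k (reach-mono j≤k r)
  ... | inj₂ refl      = r

  reach-cons : ∀ k {x z y : V} → T (adj G x z) → T (reach G k z y) → T (reach G (suc k) x y)
  reach-cons k {z = z} a r = from T-∨ (inj₂ (any⁺ _ (lose (∈-allFin z) (from T-∧ (a , r)))))

  reach-suc⁻ : ∀ k {x y : V} → T (reach G (suc k) x y) →
               T (reach G k x y) ⊎ ∃ λ z → T (adj G x z) × T (reach G k z y)
  reach-suc⁻ k r with to T-∨ r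
  ... | inj₁ r′ = inj₁ r′
  ... | inj₂ s  = let (z , t) = satisfied (any⁻ _ (allFin _) s) in inj₂ (z , to T-∧ t)

  reach-snoc : ∀ k {x z y : V} → T (reach G k x z) → T (adj G z y) → T (reach G (suc k) x y)
  reach-snoc zero {x} {z} {y} r a with refl ← reach-zero⇒≡ {x} {z} r = reach-cons 0 a (reach-refl y)
  reach-snoc (suc k) r a with reach-suc⁻ k r
  ... | inj₁ r′            = reach-suc (suc k) (reach-snoc k r′ a)
  ... | inj₂ (_ , a′ , r′) = reach-cons (suc k) a′ (reach-snoc k r′ a)

  reach-suc⁻ʳ : ∀ k {x y : V} → T (reach G (suc k) x y) →
                T (reach G k x y) ⊎ ∃ λ z → T (reach G k x z) × T (adj G z y)
  reach-suc⁻ʳ zero {x} r with reach-suc⁻ 0 r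
  ... | inj₁ r′           = inj₁ r′
  ... | inj₂ (z , a , r′) with refl ← reach-zero⇒≡ {z} {_} r′ = inj₂ (x , reach-refl x , a)
  reach-suc⁻ʳ (suc k) r with reach-suc⁻ (suc k) r
  ... | inj₁ r′ with reach-suc⁻ʳ k r′
  ...   | inj₁ r″           = inj₁ (reach-suc k r″)
  ...   | inj₂ (z , r″ , b) = inj₂ (z , reach-suc k r″ , b)
  reach-suc⁻ʳ (suc k) r | inj₂ (_ , a , r′) with reach-suc⁻ʳ k r′
  ...   | inj₁ r″           = inj₁ (reach-cons k a r″)
  ...   | inj₂ (z , r″ , b) = inj₂ (z , reach-cons k a r″ , b)

  reach-++ : ∀ j k {x y z : V} → T (reach G j x y) → T (reach G k y z) → T (reach G (j + k) x z)
  reach-++ zero k {x} {y} r s with refl ← reach-zero⇒≡ {x} {y} r = s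
  reach-++ (suc j) k r s with reach-suc⁻ j r
  ... | inj₁ r′           = reach-suc (j + k) (reach-++ j k r′ s)
  ... | inj₂ (_ , a , r′) = reach-cons (j + k) a (reach-++ j k r′ s)

  reach-sym : (∀ x y → adj G x y ≡ adj G y x) →
              ∀ k {x y : V} → T (reach G k x y) → T (reach G k y x)
  reach-sym adj-sym zero {x} {y} r with refl ← reach-zero⇒≡ {x} {y} r = reach-refl x
  reach-sym adj-sym (suc k) {x} r with reach-suc⁻ k r
  ... | inj₁ r′           = reach-suc k (reach-sym adj-sym k r′)
  ... | inj₂ (z , a , r′) = reach-snoc k (reach-sym adj-sym k r′) (subst T (adj-sym x z) a)

  IsDistance : V → V → ℕ → Set
  IsDistance x y d = T (reach G d x y) × (∀ {i} → i < d → ¬ T (reach G i x y))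

  isDistance-unique : ∀ {x y d e} → IsDistance x y d → IsDistance x y e → d ≡ e
  isDistance-unique {d = d} {e} (r , min) (s , min′) with ℕ.<-cmp d e
  ... | tri< d<e _ _ = ⊥-elim (min′ d<e r)
  ... | tri≈ _ d≡e _ = d≡e
  ... | tri> _ _ e<d = ⊥-elim (min e<d s)

  reach⇒isDistance : ∀ k {x y} → T (reach G k x y) → ∃ (IsDistance x y)
  reach⇒isDistance zero    r = 0 , r , λ ()
  reach⇒isDistance (suc k) {x} {y} r with T? (reach G k x y)
  ... | yes r′ = reach⇒isDistance k r′
  ... | no ¬r′ = suc k , r , λ i<1+k rᵢ → ¬r′ (reach-mono (ℕ.≤-pred i<1+k) rᵢ)

  isDistance-pred : ∀ {x y d} → IsDistance x y (suc d) → ∃ λ z → IsDistance x z d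
  isDistance-pred {d = d} (r , min) with reach-suc⁻ʳ d r
  ... | inj₁ r′           = ⊥-elim (min ℕ.≤-refl r′)
  ... | inj₂ (z , r′ , a) = z , r′ , λ {i} i<d rᵢ → min (s≤s i<d) (reach-snoc i rᵢ a)

  isDistance-layer : ∀ {x y d k} → k ≤ d → IsDistance x y d → ∃ λ z → IsDistance x z k
  isDistance-layer {d = zero}  z≤n D = _ , D
  isDistance-layer {d = suc d} k≤1+d D with ℕ.m≤n⇒m<n∨m≡n k≤1+d
  ... | inj₁ (s≤s k≤d) = isDistance-layer k≤d (proj₂ (isDistance-pred D))
  ... | inj₂ refl      = _ , D

  private
    layer : ∀ {x y d} → IsDistance x y d → order G ≤ d →
            (i : Fin (suc (order G))) → ∃ λ z → IsDistance x z (toℕ i)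
    layer D n≤d i = isDistance-layer (ℕ.≤-trans (ℕ.≤-pred (toℕ<n i)) n≤d) D

  -- a shortest walk of length d passes through vertices at each distance 0, …, d from x;
  -- these are pairwise distinct, so by pigeonhole d < order G
  isDistance<order : ∀ {x y d} → IsDistance x y d → d < order G
  isDistance<order {x} {d = d} D with d ℕ.<? order G
  ... | yes d<n = d<n
  ... | no  d≮n with pigeonhole (ℕ.n<1+n _) (proj₁ ∘ layer D (ℕ.≮⇒≥ d≮n))
  ...   | i , j , i<j , zᵢ≡zⱼ = ⊥-elim (ℕ.<⇒≢ i<j (isDistance-unique
            (subst (λ z → IsDistance x z (toℕ i)) zᵢ≡zⱼ (proj₂ (layer D _ i)))
            (proj₂ (layer D _ j))))

  searchDist-isDistance : ∀ {x y d} k b → IsDistance x y d → k ≤ d → d < k + b →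
                          searchDist G x y k b ≡ d
  searchDist-isDistance {d = d} k zero D k≤d d<k+0 =
    ⊥-elim (ℕ.<-irrefl refl (ℕ.≤-<-trans k≤d (subst (d <_) (ℕ.+-identityʳ k) d<k+0)))
  searchDist-isDistance {x} {y} {d} k (suc b) (r , min) k≤d d<k+1+b with reach G k x y in eq
  ... | true  = ℕ.≤-antisym k≤d (ℕ.≮⇒≥ λ k<d → min k<d (subst T (sym eq) _))
  ... | false =
    searchDist-isDistance (suc k) b (r , min) k<d (subst (d <_) (ℕ.+-suc k b) d<k+1+b)
    where
    k<d : k < d
    k<d = ℕ.≤∧≢⇒< k≤d λ { refl → subst T eq r }

  dist-isDistance : ∀ k {x y} → T (reach G k x y) → IsDistance x y (dist G x y)
  dist-isDistance k r with reach⇒isDistance k r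
  ... | d , D rewrite searchDist-isDistance 0 (order G) D z≤n (isDistance<order D) = D

  connected⇒isDistance : Connected G → ∀ x y → IsDistance x y (dist G x y)
  connected⇒isDistance (_ , walk) x y = dist-isDistance (proj₁ (walk x y)) (proj₂ (walk x y))

  dist-refl : Connected G → ∀ x → dist G x x ≡ 0
  dist-refl conn x = isDistance-unique (connected⇒isDistance conn x x) (reach-refl x , λ ())

  dist≡0⇒≡ : Connected G → ∀ {x y} → dist G x y ≡ 0 → x ≡ y
  dist≡0⇒≡ conn {x} {y} d≡0 =
    reach-zero⇒≡ (subst (λ d → T (reach G d x y)) d≡0 (proj₁ (connected⇒isDistance conn x y)))

  dist-sym : IsSimple G → Connected G → ∀ x y → dist G x y ≡ dist G y x
  dist-sym (adj-sym , _) conn x y with connected⇒isDistance conn y x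
  ... | r , min = isDistance-unique (connected⇒isDistance conn x y)
    (reach-sym adj-sym (dist G y x) r , λ {i} i<d rᵢ → min i<d (reach-sym adj-sym i rᵢ))

module _ (G H : Graph) where

  private
    P = G □ H

    π₁ : Fin (order P) → Fin (order G)
    π₁ i = proj₁ (remQuot {order G} (order H) i)

    π₂ : Fin (order P) → Fin (order H)
    π₂ i = proj₂ (remQuot {order G} (order H) i)

  adj-□-combine : ∀ u h u′ h′ → adj P (combine u h) (combine u′ h′) ≡
                  (does (u ≟ u′) ∧ adj H h h′) ∨ (does (h ≟ h′) ∧ adj G u u′)
  adj-□-combine u h u′ h′ =
    cong₂ step (remQuot-combine {k = order H} u h) (remQuot-combine {k = order H} u′ h′)
    where
    step : Fin (order G) × Fin (order H) → Fin (order G) × Fin (order H) → Bool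
    step (u₁ , v₁) (u₂ , v₂) = (does (u₁ ≟ u₂) ∧ adj H v₁ v₂) ∨ (does (v₁ ≟ v₂) ∧ adj G u₁ u₂)

  adj-□ˡ : ∀ {u u′} (h : Fin (order H)) → T (adj G u u′) → T (adj P (combine u h) (combine u′ h))
  adj-□ˡ {u} {u′} h a =
    subst T (sym (adj-□-combine u h u′ h)) (from T-∨ (inj₂ (from T-∧ (T-≟-diag h , a))))

  adj-□ʳ : ∀ (u : Fin (order G)) {h h′} → T (adj H h h′) → T (adj P (combine u h) (combine u h′))
  adj-□ʳ u {h} {h′} a =
    subst T (sym (adj-□-combine u h u h′)) (from T-∨ (inj₁ (from T-∧ (T-≟-diag u , a))))

  reach-□ˡ : ∀ a {u z} (h : Fin (order H)) →
             T (reach G a u z) → T (reach P a (combine u h) (combine z h))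
  reach-□ˡ zero {u} {z} h r with refl ← reach-zero⇒≡ G {u} {z} r = reach-refl P (combine u h)
  reach-□ˡ (suc a) h r with reach-suc⁻ G a r
  ... | inj₁ r′           = reach-suc P a (reach-□ˡ a h r′)
  ... | inj₂ (_ , e , r′) = reach-cons P a (adj-□ˡ h e) (reach-□ˡ a h r′)

  reach-□ʳ : ∀ b (u : Fin (order G)) {h w} →
             T (reach H b h w) → T (reach P b (combine u h) (combine u w))
  reach-□ʳ zero u {h} {w} r with refl ← reach-zero⇒≡ H {h} {w} r = reach-refl P (combine u h)
  reach-□ʳ (suc b) u r with reach-suc⁻ H b r
  ... | inj₁ r′           = reach-suc P b (reach-□ʳ b u r′)
  ... | inj₂ (_ , e , r′) = reach-cons P b (adj-□ʳ u e) (reach-□ʳ b u r′)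

  reach-□ : ∀ a b {u z h w} → T (reach G a u z) → T (reach H b h w) →
            T (reach P (a + b) (combine u h) (combine z w))
  reach-□ a b {z = z} {h} ra rb = reach-++ P a b (reach-□ˡ a h ra) (reach-□ʳ b z rb)

  reach-□⁻ : ∀ k {i j} → T (reach P k i j) → ∃₂ λ a b → a + b ≤ k ×
             T (reach G a (π₁ i) (π₁ j)) × T (reach H b (π₂ i) (π₂ j))
  reach-□⁻ zero {i} {j} r with refl ← reach-zero⇒≡ P {i} {j} r =
    0 , 0 , z≤n , reach-refl G (π₁ i) , reach-refl H (π₂ i)
  reach-□⁻ (suc k) r with reach-suc⁻ P k r
  ... | inj₁ r′ with reach-□⁻ k r′
  ...   | a , b , a+b≤k , ra , rb = a , b , ℕ.m≤n⇒m≤1+n a+b≤k , ra , rb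
  reach-□⁻ (suc k) r | inj₂ (z , e , r′) with reach-□⁻ k r′ | to T-∨ e
  ...   | a , b , a+b≤k , ra , rb | inj₁ step with to T-∧ step
  ...     | π₁i≡π₁z , e′ =
    a , suc b , subst (_≤ suc k) (sym (ℕ.+-suc a b)) (s≤s a+b≤k) ,
    subst (λ x → T (reach G a x (π₁ _))) (sym (T-≟⇒≡ π₁i≡π₁z)) ra , reach-cons H b e′ rb
  reach-□⁻ (suc k) r | inj₂ (z , e , r′) | a , b , a+b≤k , ra , rb | inj₂ step with to T-∧ step
  ...     | π₂i≡π₂z , e′ =
    suc a , b , s≤s a+b≤k ,
    reach-cons G a e′ ra , subst (λ x → T (reach H b x (π₂ _))) (sym (T-≟⇒≡ π₂i≡π₂z)) rb

  dist-□ : Connected G → Connected H → ∀ u h z w →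
           dist P (combine u h) (combine z w) ≡ dist G u z + dist H h w
  dist-□ cG cH u h z w =
    isDistance-unique P (dist-isDistance P (dist G u z + dist H h w) walk) (walk , shortest)
    where
    DG = connected⇒isDistance G cG u z
    DH = connected⇒isDistance H cH h w

    walk : T (reach P (dist G u z + dist H h w) (combine u h) (combine z w))
    walk = reach-□ (dist G u z) (dist H h w) {u} {z} {h} {w} (proj₁ DG) (proj₁ DH)

    shortest : ∀ {i} → i < dist G u z + dist H h w → ¬ T (reach P i (combine u h) (combine z w))
    shortest {i} i<d r with reach-□⁻ i {combine u h} {combine z w} r
    ... | a , b , a+b≤i , ra , rb = ℕ.<⇒≱ i<d (ℕ.≤-trans (ℕ.+-mono-≤ dG≤a dH≤b) a+b≤i)
      where
      uh = remQuot-combine {k = order H} u h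
      zw = remQuot-combine {k = order H} z w
      dG≤a : dist G u z ≤ a
      dG≤a = ℕ.≮⇒≥ λ a<d → proj₂ DG a<d
               (subst₂ (λ p q → T (reach G a (proj₁ p) (proj₁ q))) uh zw ra)
      dH≤b : dist H h w ≤ b
      dH≤b = ℕ.≮⇒≥ λ b<d → proj₂ DH b<d
               (subst₂ (λ p q → T (reach H b (proj₂ p) (proj₂ q))) uh zw rb)

-- a / (1 + d): shifting the denominator avoids carrying a NonZero instance
frac : ℕ → ℕ → ℚ
frac a d = + a / suc d

private
  toℚᵘ-frac : ∀ a d → toℚᵘ (frac a d) ℚᵘ.≃ mkℚᵘ (+ a) d
  toℚᵘ-frac a d = ℚ.toℚᵘ-fromℚᵘ (mkℚᵘ (+ a) d)

frac-≤ : ∀ a d b e → a * suc e ≤ b * suc d → frac a d ℚ.≤ frac b e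
frac-≤ a d b e le = ℚ.toℚᵘ-cancel-≤
  (ℚᵘ.≤-respˡ-≃ (ℚᵘ.≃-sym (toℚᵘ-frac a d)) (ℚᵘ.≤-respʳ-≃ (ℚᵘ.≃-sym (toℚᵘ-frac b e))
    (*≤* (subst₂ ℤ._≤_ (ℤ.pos-* a (suc e)) (ℤ.pos-* b (suc d)) (+≤+ le)))))

frac-cong : ∀ a d b e → a * suc e ≡ b * suc d → frac a d ≡ frac b e
frac-cong a d b e eq =
  ℚ.≤-antisym (frac-≤ a d b e (ℕ.≤-reflexive eq)) (frac-≤ b e a d (ℕ.≤-reflexive (sym eq)))

frac-+ : ∀ a b d → frac a d ℚ.+ frac b d ≡ frac (a + b) d
frac-+ a b d = ℚ.toℚᵘ-injective (begin
  toℚᵘ (frac a d ℚ.+ frac b d)         ≈⟨ ℚ.toℚᵘ-homo-+ (frac a d) (frac b d) ⟩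
  toℚᵘ (frac a d) ℚᵘ.+ toℚᵘ (frac b d) ≈⟨ ℚᵘ.+-cong (toℚᵘ-frac a d) (toℚᵘ-frac b d) ⟩
  mkℚᵘ (+ a) d ℚᵘ.+ mkℚᵘ (+ b) d       ≈⟨ *≡* cross ⟩
  mkℚᵘ (+ (a + b)) d                   ≈⟨ ℚᵘ.≃-sym (toℚᵘ-frac (a + b) d) ⟩
  toℚᵘ (frac (a + b) d)                ∎)
  where
  open import Relation.Binary.Reasoning.Setoid ℚᵘ.≃-setoid
  D = suc d
  ring : ∀ a b D → (a ℤ.* D ℤ.+ b ℤ.* D) ℤ.* D ≡ (a ℤ.+ b) ℤ.* (D ℤ.* D)
  ring = ℤ-Ring.solve-∀
  cross : (+ a ℤ.* + D ℤ.+ + b ℤ.* + D) ℤ.* + D ≡ + (a + b) ℤ.* + (D * D)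
  cross = trans (ring (+ a) (+ b) (+ D)) (sym (cong₂ ℤ._*_ (ℤ.pos-+ a b) (ℤ.pos-* D D)))

sumℚ≡sum : ∀ n (f : Fin n → ℚ) → sumℚ n f ≡ sum f
sumℚ≡sum zero    f = refl
sumℚ≡sum (suc n) f = cong (f Fin.zero ℚ.+_) (sumℚ≡sum n (f ∘ Fin.suc))

sumℚ-cong : ∀ n {f g : Fin n → ℚ} → (∀ i → f i ≡ g i) → sumℚ n f ≡ sumℚ n g
sumℚ-cong zero    f≗g = refl
sumℚ-cong (suc n) f≗g = cong₂ ℚ._+_ (f≗g Fin.zero) (sumℚ-cong n (f≗g ∘ Fin.suc))

sumℚ-mono-≤ : ∀ n {f g : Fin n → ℚ} → (∀ i → f i ℚ.≤ g i) → sumℚ n f ℚ.≤ sumℚ n g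
sumℚ-mono-≤ zero    f≤g = ℚ.≤-refl
sumℚ-mono-≤ (suc n) f≤g = ℚ.+-mono-≤ (f≤g Fin.zero) (sumℚ-mono-≤ n (f≤g ∘ Fin.suc))

sumℚ-mono-< : ∀ n {f g : Fin n → ℚ} → (∀ i → f i ℚ.≤ g i) →
              ∀ v → f v ℚ.< g v → sumℚ n f ℚ.< sumℚ n g
sumℚ-mono-< (suc n) f≤g Fin.zero    fv<gv =
  ℚ.+-mono-<-≤ fv<gv (sumℚ-mono-≤ n (f≤g ∘ Fin.suc))
sumℚ-mono-< (suc n) f≤g (Fin.suc v) fv<gv =
  ℚ.+-mono-≤-< (f≤g Fin.zero) (sumℚ-mono-< n (f≤g ∘ Fin.suc) v fv<gv)

sumℚ-nonneg : ∀ n {f : Fin n → ℚ} → (∀ i → 0ℚ ℚ.≤ f i) → 0ℚ ℚ.≤ sumℚ n f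
sumℚ-nonneg zero    f≥0 = ℚ.≤-refl
sumℚ-nonneg (suc n) f≥0 = ℚ.+-mono-≤ (f≥0 Fin.zero) (sumℚ-nonneg n (f≥0 ∘ Fin.suc))

term≤sumℚ : ∀ n {f : Fin n → ℚ} → (∀ i → 0ℚ ℚ.≤ f i) → ∀ v → f v ℚ.≤ sumℚ n f
term≤sumℚ (suc n) {f} f≥0 Fin.zero = subst (ℚ._≤ sumℚ (suc n) f) (ℚ.+-identityʳ (f Fin.zero))
  (ℚ.+-monoʳ-≤ (f Fin.zero) (sumℚ-nonneg n (f≥0 ∘ Fin.suc)))
term≤sumℚ (suc n) {f} f≥0 (Fin.suc v) = subst (ℚ._≤ sumℚ (suc n) f) (ℚ.+-identityˡ (f (Fin.suc v)))
  (ℚ.+-mono-≤ (f≥0 Fin.zero) (term≤sumℚ n (f≥0 ∘ Fin.suc) v))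

pair≤sumℚ : ∀ n {f : Fin n → ℚ} → (∀ i → 0ℚ ℚ.≤ f i) →
            ∀ v w → v ≢ w → f v ℚ.+ f w ℚ.≤ sumℚ n f
pair≤sumℚ (suc n) f≥0 Fin.zero Fin.zero 0≢0 = ⊥-elim (0≢0 refl)
pair≤sumℚ (suc n) {f} f≥0 Fin.zero (Fin.suc w) _ =
  ℚ.+-monoʳ-≤ (f Fin.zero) (term≤sumℚ n (f≥0 ∘ Fin.suc) w)
pair≤sumℚ (suc n) {f} f≥0 (Fin.suc v) Fin.zero _ =
  subst (ℚ._≤ sumℚ (suc n) f) (ℚ.+-comm (f Fin.zero) (f (Fin.suc v)))
    (pair≤sumℚ (suc n) f≥0 Fin.zero (Fin.suc v) λ ())
pair≤sumℚ (suc n) {f} f≥0 (Fin.suc v) (Fin.suc w) v≢w =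
  subst (ℚ._≤ sumℚ (suc n) f) (ℚ.+-identityˡ _)
    (ℚ.+-mono-≤ (f≥0 Fin.zero) (pair≤sumℚ n (f≥0 ∘ Fin.suc) v w (v≢w ∘ cong Fin.suc)))

sumℚ-const : ∀ n a d → sumℚ n (λ _ → frac a d) ≡ frac (n * a) d
sumℚ-const zero    a d = frac-cong 0 0 0 d refl
sumℚ-const (suc n) a d = trans (cong (frac a d ℚ.+_) (sumℚ-const n a d)) (frac-+ a (n * a) d)

sumℚ-zero : ∀ n → sumℚ n (λ _ → 0ℚ) ≡ 0ℚ
sumℚ-zero n = trans (sumℚ≡sum n _) (sum-replicate-zero n)

sumℚ-++ : ∀ a b (g : Fin (a + b) → ℚ) →
          sumℚ (a + b) g ≡ sumℚ a (λ i → g (i ↑ˡ b)) ℚ.+ sumℚ b (λ j → g (a ↑ʳ j))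
sumℚ-++ zero    b g = sym (ℚ.+-identityˡ _)
sumℚ-++ (suc a) b g =
  trans (cong (g Fin.zero ℚ.+_) (sumℚ-++ a b (g ∘ Fin.suc))) (sym (ℚ.+-assoc (g Fin.zero) _ _))

sumℚ-combine : ∀ n m (g : Fin (n * m) → ℚ) →
               sumℚ (n * m) g ≡ sumℚ n (λ u → sumℚ m (λ h → g (combine u h)))
sumℚ-combine zero    m g = refl
sumℚ-combine (suc n) m g = trans (sumℚ-++ m (n * m) g)
  (cong (sumℚ m (λ h → g (h ↑ˡ (n * m))) ℚ.+_) (sumℚ-combine n m (g ∘ (m ↑ʳ_))))

sumℚ-comm : ∀ n m (F : Fin n → Fin m → ℚ) →
            sumℚ n (λ u → sumℚ m (F u)) ≡ sumℚ m (λ h → sumℚ n (λ u → F u h))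
sumℚ-comm n m F =
  trans (sumℚ²≡sum² n m F) (trans (∑-comm F) (sym (sumℚ²≡sum² m n (λ h u → F u h))))
  where
  sumℚ²≡sum² : ∀ n m (F : Fin n → Fin m → ℚ) →
               sumℚ n (λ u → sumℚ m (F u)) ≡ sum (λ u → sum (F u))
  sumℚ²≡sum² n m F = trans (sumℚ-cong n (λ u → sumℚ≡sum m (F u))) (sumℚ≡sum n _)

sumℚ-if : ∀ n (b : Bool) (f : Fin n → ℚ) →
          sumℚ n (λ i → if b then 0ℚ else f i) ≡ (if b then 0ℚ else sumℚ n f)
sumℚ-if n true  f = sumℚ-zero n
sumℚ-if n false f = refl

if-≡ᵇ-≢ : ∀ {a b} (q : ℚ) → a ≢ b → (if a ≡ᵇ b then 0ℚ else q) ≡ q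
if-≡ᵇ-≢ {a} {b} q a≢b rewrite dec-false (a ℕ.≟ b) a≢b = refl

if-nonneg : ∀ (b : Bool) {q : ℚ} → 0ℚ ℚ.≤ q → 0ℚ ℚ.≤ (if b then 0ℚ else q)
if-nonneg true  _   = ℚ.≤-refl
if-nonneg false q≥0 = q≥0

pair≤masked-sumℚ : ∀ n (a a′ : Fin n → ℕ) {f : Fin n → ℚ} → (∀ i → 0ℚ ℚ.≤ f i) →
                   ∀ {r v w} → v ≢ w → a v ≢ a′ v → a w ≢ a′ w → r ℚ.≤ f v → r ℚ.≤ f w →
                   r ℚ.+ r ℚ.≤ sumℚ n (λ i → if a i ≡ᵇ a′ i then 0ℚ else f i)
pair≤masked-sumℚ n a a′ {f} f≥0 {r} {v} {w} v≢w aᵥ≢a′ᵥ a_w≢a′_w r≤fv r≤fw = begin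
  r ℚ.+ r               ≤⟨ ℚ.+-mono-≤ r≤fv r≤fw ⟩
  f v ℚ.+ f w           ≡⟨ cong₂ ℚ._+_ (if-≡ᵇ-≢ (f v) aᵥ≢a′ᵥ) (if-≡ᵇ-≢ (f w) a_w≢a′_w) ⟨
  masked v ℚ.+ masked w ≤⟨ pair≤sumℚ n (λ i → if-nonneg (a i ≡ᵇ a′ i) (f≥0 i)) v w v≢w ⟩
  sumℚ n masked         ∎
  where
  open ℚ.≤-Reasoning
  masked : Fin n → ℚ
  masked i = if a i ≡ᵇ a′ i then 0ℚ else f i

1≤sumℚ-⊓ : ∀ n (b : Fin n → Bool) (a : Fin n → ℚ) → (∀ i → 0ℚ ℚ.≤ a i) →
           1ℚ ℚ.≤ sumℚ n (λ i → if b i then 0ℚ else a i) →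
           1ℚ ℚ.≤ sumℚ n (λ i → if b i then 0ℚ else 1ℚ ℚ.⊓ a i)
1≤sumℚ-⊓ n b a a≥0 1≤∑a with any? (λ i → (b i Bool.≟ false) ×-dec (1ℚ ℚ.≤? a i))
... | yes (i , bᵢ≡false , 1≤aᵢ) =
  ℚ.≤-trans (ℚ.≤-reflexive (sym capped≡1)) (term≤sumℚ n capped≥0 i)
  where
  capped≥0 : ∀ j → 0ℚ ℚ.≤ (if b j then 0ℚ else 1ℚ ℚ.⊓ a j)
  capped≥0 j = if-nonneg (b j) (ℚ.⊓-glb (ℚ.nonNegative⁻¹ 1ℚ) (a≥0 j))
  capped≡1 : (if b i then 0ℚ else 1ℚ ℚ.⊓ a i) ≡ 1ℚ
  capped≡1 rewrite bᵢ≡false = ℚ.p≤q⇒p⊓q≡p 1≤aᵢ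
... | no ∄ = subst (1ℚ ℚ.≤_) (sumℚ-cong n uncapped) 1≤∑a
  where
  uncapped : ∀ i → (if b i then 0ℚ else a i) ≡ (if b i then 0ℚ else 1ℚ ℚ.⊓ a i)
  uncapped i with b i in bᵢ≡
  ... | true  = refl
  ... | false = sym (ℚ.p≥q⇒p⊓q≡q (ℚ.<⇒≤ (ℚ.≰⇒> λ 1≤aᵢ → ∄ (i , bᵢ≡ , 1≤aᵢ))))

Resolves : (G : Graph) → Fin (order G) → Fin (order G) → Fin (order G) → Set
Resolves G x y z = dist G x z ≢ dist G y z

Twins : (G : Graph) → Fin (order G) → Fin (order G) → Set
Twins G v t = ∀ z → z ≢ v → z ≢ t → dist G v z ≡ dist G t z

module _ (G : Graph) where

  private
    V = Fin (order G)
    n = order G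

  resolves-self : Connected G → ∀ {x y : V} → x ≢ y → Resolves G x y x
  resolves-self conn {x} x≢y dₓₓ≡dᵧₓ =
    x≢y (sym (dist≡0⇒≡ G conn (trans (sym dₓₓ≡dᵧₓ) (dist-refl G conn x))))

  resolves-other : Connected G → ∀ {x y : V} → x ≢ y → Resolves G x y y
  resolves-other conn {y = y} x≢y dₓᵧ≡dᵧᵧ =
    x≢y (dist≡0⇒≡ G conn (trans dₓᵧ≡dᵧᵧ (dist-refl G conn y)))

  private
    twinsAt? : ∀ v t z → Dec (z ≢ v → z ≢ t → dist G v z ≡ dist G t z)
    twinsAt? v t z = ¬? (z ≟ v) →-dec ¬? (z ≟ t) →-dec (dist G v z ℕ.≟ dist G t z)

  twins? : ∀ v t → Dec (Twins G v t)
  twins? v t = all? (twinsAt? v t)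

  ¬twins⇒resolving-vertex : ∀ {v t : V} → ¬ Twins G v t →
                            ∃ λ z → z ≢ v × z ≢ t × Resolves G v t z
  ¬twins⇒resolving-vertex {v} {t} ¬twins with ¬∀⟶∃¬ n _ (twinsAt? v t) ¬twins
  ... | z , ¬twinsAt with z ≟ v | z ≟ t | dist G v z ℕ.≟ dist G t z
  ...   | yes z≡v | _       | _        = ⊥-elim (¬twinsAt λ z≢v → ⊥-elim (z≢v z≡v))
  ...   | no _    | yes z≡t | _        = ⊥-elim (¬twinsAt λ _ z≢t → ⊥-elim (z≢t z≡t))
  ...   | no _    | no _    | yes dᵥ≡dₜ = ⊥-elim (¬twinsAt λ _ _ → dᵥ≡dₜ)
  ...   | no z≢v  | no z≢t  | no dᵥ≢dₜ = z , z≢v , z≢t , dᵥ≢dₜ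

  thirdAt : V → V → ℚ
  thirdAt v z = if does (z ≟ v) then frac 1 2 else ½

  private
    ½≤thirdAt : ∀ {v z} → z ≢ v → ½ ℚ.≤ thirdAt v z
    ½≤thirdAt {v} {z} z≢v rewrite dec-false (z ≟ v) z≢v = ℚ.≤-refl

    thirdAt≤½ : ∀ v z → thirdAt v z ℚ.≤ ½
    thirdAt≤½ v z with z ≟ v
    ... | yes _ = frac-≤ 1 2 1 1 (s≤s (s≤s z≤n))
    ... | no  _ = ℚ.≤-refl

    thirdAt≥0 : ∀ v z → 0ℚ ℚ.≤ thirdAt v z
    thirdAt≥0 v z with z ≟ v
    ... | yes _ = frac-≤ 0 0 1 2 z≤n
    ... | no  _ = frac-≤ 0 0 1 1 z≤n

  twinless⇒thirdAt-resolving : Connected G → ∀ v → (∀ t → t ≢ v → ¬ Twins G v t) →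
                               IsResolvingFunction G (thirdAt v)
  twinless⇒thirdAt-resolving conn v twinless =
    (λ z → thirdAt≥0 v z , ℚ.≤-trans (thirdAt≤½ v z) (frac-≤ 1 1 1 0 (s≤s z≤n))) , resolves
    where
    resolved : ∀ {x y a b} → a ≢ b → Resolves G x y a → Resolves G x y b → a ≢ v → b ≢ v →
               1ℚ ℚ.≤ sumOverR G (thirdAt v) x y
    resolved {x} {y} a≢b Ra Rb a≢v b≢v =
      pair≤masked-sumℚ n (dist G x) (dist G y) (thirdAt≥0 v) a≢b Ra Rb (½≤thirdAt a≢v) (½≤thirdAt b≢v)

    resolves : ∀ x y → x ≢ y → 1ℚ ℚ.≤ sumOverR G (thirdAt v) x y
    resolves x y x≢y with x ≟ v | y ≟ v
    ... | no x≢v   | no y≢v =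
      resolved x≢y (resolves-self conn x≢y) (resolves-other conn x≢y) x≢v y≢v
    ... | yes refl | _      =
      let (z , z≢v , z≢y , Rz) = ¬twins⇒resolving-vertex (twinless y (x≢y ∘ sym))
      in resolved (z≢y ∘ sym) (resolves-other conn x≢y) Rz (x≢y ∘ sym) z≢v
    ... | no x≢v   | yes refl =
      let (z , z≢v , z≢x , Rz) = ¬twins⇒resolving-vertex (twinless x x≢v)
      in resolved (z≢x ∘ sym) (resolves-self conn x≢y) (Rz ∘ sym) x≢v z≢v

  sumℚ-thirdAt<n/2 : ∀ v → sumℚ n (thirdAt v) ℚ.< frac n 1
  sumℚ-thirdAt<n/2 v =
    subst (sumℚ n (thirdAt v) ℚ.<_) ∑½≡n/2 (sumℚ-mono-< n (thirdAt≤½ v) v thirdAt-v<½)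
    where
    ∑½≡n/2 : sumℚ n (λ _ → ½) ≡ frac n 1
    ∑½≡n/2 = trans (sumℚ-const n 1 1) (cong (λ k → frac k 1) (ℕ.*-identityʳ n))
    thirdAt-v<½ : thirdAt v v ℚ.< ½
    thirdAt-v<½ rewrite dec-true (v ≟ v) refl =
      ℚ.toℚᵘ-cancel-< (ℚᵘ.*<* (ℤ.+<+ (s≤s (s≤s (s≤s z≤n)))))

  every-vertex-has-twin : Connected G → (∀ f → IsResolvingFunction G f → frac n 1 ℚ.≤ sumℚ n f) →
                          ∀ v → ∃ λ t → t ≢ v × Twins G v t
  every-vertex-has-twin conn n/2≤ v with any? (λ t → ¬? (t ≟ v) ×-dec twins? v t)
  ... | yes twin  = twin
  ... | no  ∄twin = ⊥-elim (ℚ.<-irrefl refl (ℚ.<-≤-trans (sumℚ-thirdAt<n/2 v) (n/2≤ (thirdAt v)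
                      (twinless⇒thirdAt-resolving conn v λ t t≢v twins → ∄twin (t , t≢v , twins)))))

-- (x , w) resolves (u , h) and (u′ , h′) in G □ H, where p = d(h , w) and q = d(h′ , w)
ResolvesShifted : (G : Graph) → Fin (order G) → ℕ → Fin (order G) → ℕ → Fin (order G) → Set
ResolvesShifted G u p u′ q x = dist G u x + p ≢ dist G u′ x + q

ResolvedTwice : (G : Graph) → Fin (order G) → ℕ → Fin (order G) → ℕ → Set
ResolvedTwice G u p u′ q =
  ∃₂ λ x₁ x₂ → x₁ ≢ x₂ × ResolvesShifted G u p u′ q x₁ × ResolvesShifted G u p u′ q x₂

module _ (G : Graph) (simple : IsSimple G) (conn : Connected G) (3≤n : 3 ≤ order G)
         (twin : ∀ v → ∃ λ t → t ≢ v × Twins G v t) where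

  private
    d = dist G

    dist≢0 : ∀ {x y} → x ≢ y → d x y ≢ 0
    dist≢0 x≢y = x≢y ∘ dist≡0⇒≡ G conn

    resolvedBy-other-at-offset : ∀ {u u′} → u ≢ u′ → ∀ {p q} → p ≡ d u′ u + q →
                                 ResolvesShifted G u p u′ q u′
    resolvedBy-other-at-offset {u} {u′} u≢u′ {p} {q} p≡ eq =
      m+n≢n (d u u′ + d u′ u) q (dist≢0 u≢u′ ∘ ℕ.m+n≡0⇒m≡0 (d u u′)) (begin
        d u u′ + d u′ u + q   ≡⟨ ℕ.+-assoc (d u u′) (d u′ u) q ⟩
        d u u′ + (d u′ u + q) ≡⟨ cong (λ k → d u u′ + k) p≡ ⟨
        d u u′ + p            ≡⟨ eq ⟩
        d u′ u′ + q           ≡⟨ cong (_+ q) (dist-refl G conn u′) ⟩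
        q                     ∎)
      where open ≡-Reasoning

    -- the second vertex is a twin t ≠ u′ of u, for which d(u′,t) = d(u′,u);
    -- if u′ itself is u's twin, it is any vertex outside {u, u′}
    resolvedTwice-at-offset : ∀ {u u′} → u ≢ u′ → ∀ {p q} → p ≡ d u′ u + q → ResolvedTwice G u p u′ q
    resolvedTwice-at-offset {u} {u′} u≢u′ {p} {q} p≡ with twin u
    ... | t , t≢u , twins with t ≟ u′
    ...   | yes refl =
      let (x , x≢u , x≢t) = third-vertex 3≤n u t in
      t , x , x≢t ∘ sym , resolvedBy-other-at-offset u≢u′ p≡ ,
      λ eq → m+n≢n (d t u) q (dist≢0 t≢u) (trans (sym p≡)
               (ℕ.+-cancelˡ-≡ (d t x) p q (trans (cong (_+ p) (sym (twins x x≢u x≢t))) eq)))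
    ...   | no t≢u′ =
      u′ , t , t≢u′ ∘ sym , resolvedBy-other-at-offset u≢u′ p≡ ,
      λ eq → m+n≢n (d u t) p (dist≢0 (t≢u ∘ sym)) (trans eq d[u′,t]+q≡p)
      where
      d[u′,t]+q≡p : d u′ t + q ≡ p
      d[u′,t]+q≡p = begin
        d u′ t + q ≡⟨ cong (_+ q) (dist-sym G simple conn u′ t) ⟩
        d t u′ + q ≡⟨ cong (_+ q) (twins u′ (u≢u′ ∘ sym) (t≢u′ ∘ sym)) ⟨
        d u u′ + q ≡⟨ cong (_+ q) (dist-sym G simple conn u u′) ⟩
        d u′ u + q ≡⟨ p≡ ⟨
        p          ∎
        where open ≡-Reasoning

  resolvedTwice : ∀ {u u′} → u ≢ u′ → ∀ p q → ResolvedTwice G u p u′ q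
  resolvedTwice {u} {u′} u≢u′ p q with p ℕ.≟ d u′ u + q | q ℕ.≟ d u u′ + p
  ... | yes p≡ | _      = resolvedTwice-at-offset u≢u′ p≡
  ... | no _   | yes q≡ with resolvedTwice-at-offset (u≢u′ ∘ sym) q≡
  ...   | x₁ , x₂ , x₁≢x₂ , R₁ , R₂ = x₁ , x₂ , x₁≢x₂ , R₁ ∘ sym , R₂ ∘ sym
  resolvedTwice {u} {u′} u≢u′ p q | no p≢ | no q≢ =
    u , u′ , u≢u′ ,
    (λ eq → p≢ (trans (cong (_+ p) (sym (dist-refl G conn u))) eq)) ,
    (λ eq → q≢ (sym (trans eq (cong (_+ q) (dist-refl G conn u′)))))

module _ (G H : Graph) (connG : Connected G) (connH : Connected H) where

  private
    n = order G
    m = order H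

  sumOverR-□ : ∀ f u h u′ h′ → sumOverR (G □ H) f (combine u h) (combine u′ h′) ≡
               sumℚ n (λ x → sumℚ m (λ w →
                 if dist G u x + dist H h w ≡ᵇ dist G u′ x + dist H h′ w then 0ℚ else f (combine x w)))
  sumOverR-□ f u h u′ h′ = trans (sumℚ-combine n m _) (sumℚ-cong n λ x → sumℚ-cong m λ w →
    cong (λ b → if b then 0ℚ else f (combine x w))
         (cong₂ _≡ᵇ_ (dist-□ G H connG connH u h x w) (dist-□ G H connG connH u′ h′ x w)))

  fibreWeight : (Fin (n * m) → ℚ) → Fin n → ℚ
  fibreWeight f u = 1ℚ ℚ.⊓ sumℚ m (λ w → f (combine u w))

  sumℚ-fibreWeight≤ : ∀ f → sumℚ n (fibreWeight f) ℚ.≤ sumℚ (n * m) f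
  sumℚ-fibreWeight≤ f = ℚ.≤-trans (sumℚ-mono-≤ n λ u → ℚ.p⊓q≤q 1ℚ _)
                                  (ℚ.≤-reflexive (sym (sumℚ-combine n m f)))

  fibreWeight-resolving : ∀ f → IsResolvingFunction (G □ H) f → IsResolvingFunction G (fibreWeight f)
  fibreWeight-resolving f (bounds , resolves) =
    (λ u → ℚ.⊓-glb (ℚ.nonNegative⁻¹ 1ℚ) (F≥0 u) , ℚ.p⊓q≤p 1ℚ (F u)) , resolvesG
    where
    F : Fin n → ℚ
    F u = sumℚ m (λ w → f (combine u w))

    F≥0 : ∀ u → 0ℚ ℚ.≤ F u
    F≥0 u = sumℚ-nonneg m (λ w → proj₁ (bounds (combine u w)))

    h₀ : Fin m
    h₀ = Fin.fromℕ< (proj₁ connH)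

    fibres : ∀ x y → sumOverR (G □ H) f (combine x h₀) (combine y h₀) ≡
                     sumℚ n (λ u → if dist G x u ≡ᵇ dist G y u then 0ℚ else F u)
    fibres x y = trans (sumOverR-□ f x h₀ y h₀) (sumℚ-cong n λ u → trans
      (sumℚ-cong m λ w → cong (λ b → if b then 0ℚ else f (combine u w))
                              (≡ᵇ-+ʳ (dist G x u) (dist G y u) (dist H h₀ w)))
      (sumℚ-if m (dist G x u ≡ᵇ dist G y u) _))

    resolvesG : ∀ x y → x ≢ y → 1ℚ ℚ.≤ sumOverR G (fibreWeight f) x y
    resolvesG x y x≢y = 1≤sumℚ-⊓ n (λ u → dist G x u ≡ᵇ dist G y u) F F≥0
      (subst (1ℚ ℚ.≤_) (fibres x y) (resolves _ _ (x≢y ∘ combine-injectiveˡ x h₀ y h₀)))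

  fracDim≤sum-□ : ∀ {q} → FracDimIs G q → ∀ f → IsResolvingFunction (G □ H) f → q ℚ.≤ sumℚ (n * m) f
  fracDim≤sum-□ (_ , minimal) f res =
    ℚ.≤-trans (minimal (fibreWeight f) (fibreWeight-resolving f res)) (sumℚ-fibreWeight≤ f)

  module _ (simpleG : IsSimple G) (3≤n : 3 ≤ n) (twin : ∀ v → ∃ λ t → t ≢ v × Twins G v t)
           (m≤n : m ≤ n) where

    private
      2m-1 = pred m + m

      2m : suc 2m-1 ≡ m + m
      2m = cong (_+ m) (ℕ.suc-pred m {{>-nonZero (proj₁ connH)}})

      c : ℚ
      c = frac 1 2m-1   -- 1 / (2m)

      c≥0 : 0ℚ ℚ.≤ c
      c≥0 = frac-≤ 0 0 1 2m-1 z≤n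

      1≤sumℚ-of-pairs : ∀ k → m ≤ k → (g : Fin k → ℚ) → (∀ i → c ℚ.+ c ℚ.≤ g i) → 1ℚ ℚ.≤ sumℚ k g
      1≤sumℚ-of-pairs k m≤k g pairs = begin
        1ℚ                         ≤⟨ frac-≤ 1 0 (k * 2) 2m-1 2m≤2k ⟩
        frac (k * 2) 2m-1          ≡⟨ sumℚ-const k 2 2m-1 ⟨
        sumℚ k (λ _ → frac 2 2m-1) ≡⟨ sumℚ-cong k (λ _ → frac-+ 1 1 2m-1) ⟨
        sumℚ k (λ _ → c ℚ.+ c)     ≤⟨ sumℚ-mono-≤ k pairs ⟩
        sumℚ k g                   ∎
        where
        open ℚ.≤-Reasoning
        double : ∀ k → k + k ≡ k * 2 * 1
        double = ℕ-Ring.solve-∀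
        2m≤2k : 1 * suc 2m-1 ≤ k * 2 * 1
        2m≤2k = subst₂ _≤_ (trans (sym 2m) (sym (ℕ.*-identityˡ _))) (double k) (ℕ.+-mono-≤ m≤k m≤k)

    uniform : Fin (n * m) → ℚ
    uniform _ = c

    sumℚ-uniform : sumℚ (n * m) uniform ≡ frac n 1
    sumℚ-uniform = trans (sumℚ-const (n * m) 1 2m-1) (frac-cong (n * m * 1) 2m-1 n 1 (begin
      n * m * 1 * 2 ≡⟨ ring n m ⟩
      n * (m + m)   ≡⟨ cong (n *_) 2m ⟨
      n * suc 2m-1  ∎))
      where
      open ≡-Reasoning
      ring : ∀ n m → n * m * 1 * 2 ≡ n * (m + m)
      ring = ℕ-Ring.solve-∀

    uniform-resolving : IsResolvingFunction (G □ H) uniform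
    uniform-resolving =
      (λ _ → c≥0 , frac-≤ 1 2m-1 1 0 (s≤s z≤n)) ,
      ∀-combine λ u h → ∀-combine λ u′ h′ → resolves u h u′ h′
      where
      resolves : ∀ u h u′ h′ → combine u h ≢ combine u′ h′ →
                 1ℚ ℚ.≤ sumOverR (G □ H) uniform (combine u h) (combine u′ h′)
      resolves u h u′ h′ uh≢u′h′ rewrite sumOverR-□ uniform u h u′ h′ with u ≟ u′
      ... | yes refl = 1≤sumℚ-of-pairs n m≤n _ λ x →
        pair≤masked-sumℚ m (λ w → dist G u x + dist H h w) (λ w → dist G u x + dist H h′ w)
          (λ _ → c≥0) h≢h′
          (resolves-self H connH h≢h′ ∘ ℕ.+-cancelˡ-≡ (dist G u x) _ _)
          (resolves-other H connH h≢h′ ∘ ℕ.+-cancelˡ-≡ (dist G u x) _ _) ℚ.≤-refl ℚ.≤-refl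
        where
        h≢h′ : h ≢ h′
        h≢h′ = uh≢u′h′ ∘ cong (combine u)
      ... | no u≢u′ = subst (1ℚ ℚ.≤_) (sym (sumℚ-comm n m _)) (1≤sumℚ-of-pairs m ℕ.≤-refl _ λ w →
        let (x₁ , x₂ , x₁≢x₂ , R₁ , R₂) =
              resolvedTwice G simpleG connG 3≤n twin u≢u′ (dist H h w) (dist H h′ w)
        in pair≤masked-sumℚ n (λ x → dist G u x + dist H h w) (λ x → dist G u′ x + dist H h′ w)
             (λ _ → c≥0) x₁≢x₂ R₁ R₂ ℚ.≤-refl ℚ.≤-refl)

    □-resolving-of-weight-n/2 : ∃ λ f → IsResolvingFunction (G □ H) f × sumℚ (n * m) f ≡ frac n 1
    □-resolving-of-weight-n/2 = uniform , uniform-resolving , sumℚ-uniform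

-- H need not be simple: it enters only through its distances
theorem4p3 : (G H : Graph) → IsSimple G → Connected G → 3 ≤ order G
    → FracDimIs G ((+ order G) / 2)
    → IsSimple H → Connected H → order H ≤ order G
    → FracDimIs (G □ H) ((+ order G) / 2)
theorem4p3 G H simpleG connG 3≤n dimG _ connH m≤n =
  □-resolving-of-weight-n/2 G H connG connH simpleG 3≤n twin m≤n ,
  fracDim≤sum-□ G H connG connH dimG
  where
  twin : ∀ v → ∃ λ t → t ≢ v × Twins G v t
  twin = every-vertex-has-twin G connG (proj₂ dimG)
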